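{- For every positive integer $n$, let $\mathcal{L}_n$ be the lattice of partitions of $n$ under the dominance ordering and $\mathcal{J}(\mathcal{L}_n)$ its set of join-irreducible elements. Then $|\mathcal{J}(\mathcal{L}_1)|=0$, and for every $n\geq 1$, \[|\mathcal{J}(\mathcal{L}_{n+1})|=|\mathcal{J}(\mathcal{L}_n)|+\left\lfloor \frac{n}{3}\right\rfloor+1.\]
   Context: A partition of a positive integer $n$ is an $n$-tuple $(a_1,\ldots,a_n)$ of natural numbers with $a_1\geq a_2\geq\cdots\geq a_n\geq 0$ and $a_1+\cdots+a_n=n$ (trailing zeros may be omitted, and are implicitly added when comparing tuples of different lengths). The dominance ordering on partitions of $n$ is: $(a_i)\geq(b_i)$ iff $\sum_{i=1}^j a_i\geq\sum_{i=1}^j b_i$ for all $j\geq1$; with this order the partitions of $n$ form a lattice $\mathcal{L}_n$. An element of a lattice is join-irreducible if it is not the least element and whenever it equals $b\vee c$ it equals $b$ or $c$ (in a finite lattice: it covers exactly one element). -}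

module Defs where

open import Data.Nat using (ℕ; zero; suc; _+_; _≤_)
open import Data.Fin using (Fin; toℕ)
open import Data.Vec using (Vec; []; _∷_; lookup; sum)
open import Data.List using (List; length)
open import Data.List.Membership.Propositional using (_∈_)
open import Data.List.Relation.Unary.Unique.Propositional using (Unique)
open import Data.Product using (Σ; _×_)
open import Data.Sum using (_⊎_)
open import Relation.Nullary using (¬_)
open import Relation.Binary.PropositionalEquality using (_≡_)

IsPartition : (n : ℕ) → Vec ℕ n → Set
IsPartition n a =
  (∀ (i j : Fin n) → toℕ i ≤ toℕ j → lookup a j ≤ lookup a i) × (sum a ≡ n)

-- prefix sum a_1 + … + a_j (all entries if j ≥ length)
psum : ∀ {n} → Vec ℕ n → ℕ → ℕ
psum []       j       = 0
psum (x ∷ xs) zero    = 0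
psum (x ∷ xs) (suc j) = x + psum xs j

_⊴_ : ∀ {n} → Vec ℕ n → Vec ℕ n → Set
b ⊴ a = ∀ (j : ℕ) → psum b j ≤ psum a j

IsJoin : (n : ℕ) → Vec ℕ n → Vec ℕ n → Vec ℕ n → Set
IsJoin n a b c =
  b ⊴ a × c ⊴ a ×
  (∀ (d : Vec ℕ n) → IsPartition n d → b ⊴ d → c ⊴ d → a ⊴ d)

JoinIrreducible : (n : ℕ) → Vec ℕ n → Set
JoinIrreducible n a =
  ¬ (∀ (b : Vec ℕ n) → IsPartition n b → a ⊴ b) ×
  (∀ (b c : Vec ℕ n) → IsPartition n b → IsPartition n c →
     IsJoin n a b c → (a ≡ b) ⊎ (a ≡ c))

NumJoinIrreducibles : ℕ → ℕ → Set
NumJoinIrreducibles n k =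
  Σ (List (Vec ℕ n)) λ L →
    Unique L ×
    (∀ a → a ∈ L → IsPartition n a × JoinIrreducible n a) ×
    (∀ a → IsPartition n a → JoinIrreducible n a → a ∈ L) ×
    length L ≡ k

module Submission where

-- A partition is join-irreducible exactly when it has a single lower cover. Lower covers
-- arise by moving one unit from a row p to a later row q (Brylawski). Two cover moves that
-- do not overlap have the partition as their join, while if every drop of at least two in a
-- straddles one cover move, a strictly dominance-smaller partition must lie below that cover,
-- since along each maximal run of strict dominance the larger partition drops by two.
-- Hence the join-irreducible partitions of n are (y+1)^r y^(k−r) 1^(n−s), where s = yk + r is
-- the sum of the k parts exceeding one, with 2k ≤ s ≤ n and s = n, 3k ≤ s or s = 2k.
-- Going from n to n + 1 keeps these pairs (k , s), moving s = n to s = n + 1, and adds the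
-- ⌊n/3⌋ pairs (k , n) with 3k ≤ n and the single pair with s = 2k ∈ {n , n + 1}.

open import Defs
open import Data.Empty using (⊥-elim)
open import Data.Fin using (Fin; toℕ)
open import Data.List using (List; []; _∷_; length; map; _++_; upTo)
open import Data.List.Membership.Propositional using (_∈_)
open import Data.List.Membership.Propositional.Properties
  using (∈-map⁺; ∈-map⁻; ∈-++⁺ˡ; ∈-++⁺ʳ; ∈-++⁻; ∈-upTo⁺; ∈-upTo⁻)
open import Data.List.Membership.Propositional.Properties.WithK using (unique∧set⇒bag)
open import Data.List.Properties using (length-map; length-++; length-upTo)
open import Data.List.Relation.Binary.BagAndSetEquality using (∼bag⇒↭)
open import Data.List.Relation.Binary.Disjoint.Propositional using (Disjoint)
open import Data.List.Relation.Binary.Permutation.Propositional.Properties using (↭-length)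
import Data.List.Relation.Unary.All as All
import Data.List.Relation.Unary.All.Properties as All
open import Data.List.Relation.Unary.AllPairs using ([]; _∷_)
open import Data.List.Relation.Unary.Any using (here; there)
open import Data.List.Relation.Unary.Unique.Propositional using (Unique)
import Data.List.Relation.Unary.Unique.Propositional.Properties as Unique
open import Data.Nat using (ℕ; zero; suc; _+_; _*_; _∸_; _/_; _%_; _≤_; _<_; z≤n; s≤s;
  _≟_; _≤?_; _<?_; _⊓_; NonZero; >-nonZero; pred)
open import Data.Nat.DivMod
open import Data.Nat.Properties
open import Algebra.Properties.CommutativeSemigroup +-commutativeSemigroup using (interchange)
open import Data.Product using (Σ; _×_; _,_; proj₁; proj₂; uncurry)
open import Data.Product.Properties using (,-injectiveˡ; ,-injectiveʳ)
open import Data.Sum using (_⊎_; inj₁; inj₂)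
open import Data.Vec using (Vec; []; _∷_; lookup; sum)
open import Data.Vec.Properties using (≡-dec)
open import Function using (case_of_)
open import Function.Bundles using (mk⇔)
open import Relation.Binary using (tri<; tri≈; tri>)
open import Relation.Binary.PropositionalEquality
  using (_≡_; refl; sym; trans; cong; cong₂; subst; _≢_; ≢-sym; module ≡-Reasoning)
open import Relation.Nullary using (¬_; Dec; yes; no)
open import Relation.Unary using (Decidable)

-- entry a i is the paper's a_{i+1}: entries are numbered from 0 and read as 0 past the end.
entry : ∀ {n} → Vec ℕ n → ℕ → ℕ
entry []       i       = 0
entry (x ∷ xs) zero    = x
entry (x ∷ xs) (suc i) = entry xs i

lookup≡entry : ∀ {n} (a : Vec ℕ n) (i : Fin n) → lookup a i ≡ entry a (toℕ i)
lookup≡entry (x ∷ xs) Fin.zero    = refl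
lookup≡entry (x ∷ xs) (Fin.suc i) = lookup≡entry xs i

entry-beyond : ∀ {n} (a : Vec ℕ n) {i} → n ≤ i → entry a i ≡ 0
entry-beyond []       _         = refl
entry-beyond (x ∷ xs) (s≤s n≤i) = entry-beyond xs n≤i

sum≡psum : ∀ {n} (a : Vec ℕ n) → sum a ≡ psum a n
sum≡psum []       = refl
sum≡psum (x ∷ xs) = cong (x +_) (sum≡psum xs)

psum-zero : ∀ {n} (a : Vec ℕ n) → psum a 0 ≡ 0
psum-zero []      = refl
psum-zero (x ∷ a) = refl

psum-suc : ∀ {n} (a : Vec ℕ n) j → psum a (suc j) ≡ psum a j + entry a j
psum-suc []       j       = refl
psum-suc (x ∷ xs) zero    rewrite psum-zero xs = +-identityʳ x
psum-suc (x ∷ xs) (suc j) rewrite psum-suc xs j = sym (+-assoc x (psum xs j) (entry xs j))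

psum-monotone : ∀ {n} (a : Vec ℕ n) {i j} → i ≤ j → psum a i ≤ psum a j
psum-monotone a {i} {zero}  z≤n = ≤-refl
psum-monotone a {i} {suc j} i≤1+j with m≤n⇒m<n∨m≡n i≤1+j
... | inj₂ refl      = ≤-refl
... | inj₁ (s≤s i≤j) = ≤-trans (psum-monotone a i≤j) (subst (psum a j ≤_) (sym (psum-suc a j)) (m≤m+n _ _))

psum-beyond : ∀ {n} (a : Vec ℕ n) {j} → n ≤ j → psum a j ≡ psum a n
psum-beyond a {zero}  z≤n = refl
psum-beyond a {suc j} n≤1+j with m≤n⇒m<n∨m≡n n≤1+j
... | inj₂ refl = refl
... | inj₁ (s≤s n≤j) rewrite psum-suc a j | entry-beyond a n≤j | +-identityʳ (psum a j) = psum-beyond a n≤j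

pred[m]<m : ∀ {m} → 0 < m → pred m < m
pred[m]<m (s≤s _) = ≤-refl

Decreasing : (ℕ → ℕ) → Set
Decreasing f = ∀ i → f (suc i) ≤ f i

decreasing⇒antitone : ∀ {f} → Decreasing f → ∀ {i j} → i ≤ j → f j ≤ f i
decreasing⇒antitone dec {i} {zero}  z≤n = ≤-refl
decreasing⇒antitone dec {i} {suc j} i≤1+j with m≤n⇒m<n∨m≡n i≤1+j
... | inj₂ refl      = ≤-refl
... | inj₁ (s≤s i≤j) = ≤-trans (dec j) (decreasing⇒antitone dec i≤j)

IsPartition′ : (n : ℕ) → Vec ℕ n → Set
IsPartition′ n a = Decreasing (entry a) × psum a n ≡ n

entry-decreasing : ∀ {n} (a : Vec ℕ n) → (∀ (i j : Fin n) → toℕ i ≤ toℕ j → lookup a j ≤ lookup a i) →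
                   Decreasing (entry a)
entry-decreasing []           h i       = z≤n
entry-decreasing (x ∷ [])     h zero    = z≤n
entry-decreasing (x ∷ y ∷ a)  h zero    = h Fin.zero (Fin.suc Fin.zero) z≤n
entry-decreasing (x ∷ a)      h (suc i) = entry-decreasing a (λ i j i≤j → h (Fin.suc i) (Fin.suc j) (s≤s i≤j)) i

IsPartition⇒IsPartition′ : ∀ {n} (a : Vec ℕ n) → IsPartition n a → IsPartition′ n a
IsPartition⇒IsPartition′ a (antitone , sum≡n) = entry-decreasing a antitone , trans (sym (sum≡psum a)) sum≡n

IsPartition′⇒IsPartition : ∀ {n} (a : Vec ℕ n) → IsPartition′ n a → IsPartition n a
IsPartition′⇒IsPartition a (dec , psum≡n) = antitone , trans (sum≡psum a) psum≡n
  where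
  antitone : ∀ i j → toℕ i ≤ toℕ j → lookup a j ≤ lookup a i
  antitone i j i≤j rewrite lookup≡entry a i | lookup≡entry a j = decreasing⇒antitone dec i≤j

fromFun : (n : ℕ) → (ℕ → ℕ) → Vec ℕ n
fromFun zero    f = []
fromFun (suc n) f = f 0 ∷ fromFun n (λ i → f (suc i))

entry-fromFun : ∀ n f {i} → i < n → entry (fromFun n f) i ≡ f i
entry-fromFun (suc n) f {zero}  _         = refl
entry-fromFun (suc n) f {suc i} (s≤s i<n) = entry-fromFun n (λ i → f (suc i)) i<n

entry-ext : ∀ {n} (a b : Vec ℕ n) → (∀ i → i < n → entry a i ≡ entry b i) → a ≡ b
entry-ext []      []      h = refl
entry-ext (x ∷ a) (y ∷ b) h = cong₂ _∷_ (h 0 (s≤s z≤n)) (entry-ext a b (λ i i<n → h (suc i) (s≤s i<n)))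

sumBelow : (ℕ → ℕ) → ℕ → ℕ
sumBelow f zero    = 0
sumBelow f (suc j) = sumBelow f j + f j

psum-fromFun : ∀ n f {j} → j ≤ n → psum (fromFun n f) j ≡ sumBelow f j
psum-fromFun n f {zero}  _ = psum-zero (fromFun n f)
psum-fromFun n f {suc j} j<n
  rewrite psum-suc (fromFun n f) j | entry-fromFun n f j<n | psum-fromFun n f (≤-trans (n≤1+n j) j<n) = refl

leastBelow : ∀ {P : ℕ → Set} → Decidable P → ∀ N →
             (Σ ℕ λ k → k < N × P k × (∀ i → i < k → ¬ P i)) ⊎ (∀ i → i < N → ¬ P i)
leastBelow P? zero = inj₂ (λ i ())
leastBelow P? (suc N) with leastBelow P? N
... | inj₁ (k , k<N , Pk , minimal) = inj₁ (k , m<n⇒m<1+n k<N , Pk , minimal)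
... | inj₂ none with P? N
...   | yes PN  = inj₁ (N , ≤-refl , PN , none)
...   | no ¬PN = inj₂ λ i i<1+N → case m≤n⇒m<n∨m≡n (≤-pred i<1+N) of λ where
          (inj₁ i<N) → none i i<N
          (inj₂ refl) → ¬PN

leastUpTo : ∀ {P : ℕ → Set} → Decidable P → ∀ {N} → P N → Σ ℕ λ k → k ≤ N × P k × (∀ i → i < k → ¬ P i)
leastUpTo P? {N} PN with leastBelow P? (suc N)
... | inj₁ (k , k<1+N , Pk , below) = k , ≤-pred k<1+N , Pk , below
... | inj₂ none = ⊥-elim (none N ≤-refl PN)

-- Cover moves

shiftUnit : (ℕ → ℕ) → ℕ → ℕ → ℕ → ℕ
shiftUnit f p q i with i ≟ p | i ≟ q
... | yes _ | _     = pred (f i)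
... | no _  | yes _ = suc (f i)
... | no _  | no _  = f i

shiftUnit-source : ∀ f p q → shiftUnit f p q p ≡ pred (f p)
shiftUnit-source f p q with p ≟ p
... | yes _   = refl
... | no p≢p  = ⊥-elim (p≢p refl)

shiftUnit-target : ∀ f {p q} → p ≢ q → shiftUnit f p q q ≡ suc (f q)
shiftUnit-target f {p} {q} p≢q with q ≟ p | q ≟ q
... | yes q≡p | _     = ⊥-elim (p≢q (sym q≡p))
... | no _    | yes _ = refl
... | no _    | no q≢q = ⊥-elim (q≢q refl)

shiftUnit-other : ∀ f {p q i} → i ≢ p → i ≢ q → shiftUnit f p q i ≡ f i
shiftUnit-other f {p} {q} {i} i≢p i≢q with i ≟ p | i ≟ q
... | yes i≡p | _       = ⊥-elim (i≢p i≡p)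
... | no _    | yes i≡q = ⊥-elim (i≢q i≡q)
... | no _    | no _    = refl

shiftUnit-≤ : ∀ f {p q i} → i ≢ q → shiftUnit f p q i ≤ f i
shiftUnit-≤ f {p} {q} {i} i≢q = case i ≟ p of λ where
  (yes refl) → ≤-trans (≤-reflexive (shiftUnit-source f i q)) pred[n]≤n
  (no i≢p)   → ≤-reflexive (shiftUnit-other f i≢p i≢q)

shiftUnit-≥ : ∀ f {p q i} → i ≢ p → f i ≤ shiftUnit f p q i
shiftUnit-≥ f {p} {q} {i} i≢p = case i ≟ q of λ where
  (yes refl) → ≤-trans (n≤1+n (f i)) (≤-reflexive (sym (shiftUnit-target f (≢-sym i≢p))))
  (no i≢q)   → ≤-reflexive (sym (shiftUnit-other f i≢p i≢q))

moveUnit : ∀ {n} → Vec ℕ n → ℕ → ℕ → Vec ℕ n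
moveUnit {n} a p q = fromFun n (shiftUnit (entry a) p q)

-- The moves p → q that turn a partition into one it covers (Brylawski): a single step
-- with a drop of at least 2, or a longer step from the end of one plateau to the start of another.
CoverCondition : ∀ {n} → Vec ℕ n → ℕ → ℕ → Set
CoverCondition a p q =
  (q ≡ suc p × suc (suc (entry a q)) ≤ entry a p) ⊎
  (suc p < q × suc (entry a (suc p)) ≤ entry a p × suc (entry a q) ≤ entry a (pred q))

CoverMove : ∀ n → Vec ℕ n → ℕ → ℕ → Set
CoverMove n a p q = p < q × q < n × CoverCondition a p q

shiftUnit-decreasing : ∀ {f p q} → Decreasing f → p < q →
                       (q ≡ suc p × suc (suc (f q)) ≤ f p) ⊎ (suc p < q × suc (f (suc p)) ≤ f p × suc (f q) ≤ f (pred q)) →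
                       Decreasing (shiftUnit f p q)
shiftUnit-decreasing {f} {p} {q} dec p<q cond i = by-cases (i ≟ p) (suc i ≟ q)
  where
  by-cases : Dec (i ≡ p) → Dec (suc i ≡ q) → shiftUnit f p q (suc i) ≤ shiftUnit f p q i
  by-cases (yes refl) (yes refl)
    rewrite shiftUnit-source f i (suc i) | shiftUnit-target f (<⇒≢ p<q) = case cond of λ where
      (inj₁ (_ , drop))     → <⇒≤pred drop
      (inj₂ (1+p<1+p , _)) → ⊥-elim (<-irrefl refl 1+p<1+p)
  by-cases (yes refl) (no 1+i≢q)
    rewrite shiftUnit-source f i q = ≤-trans (shiftUnit-≤ f {p} 1+i≢q) (case cond of λ where
      (inj₁ (q≡1+i , _))    → ⊥-elim (1+i≢q (sym q≡1+i))
      (inj₂ (_ , drop , _)) → <⇒≤pred drop)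
  by-cases (no i≢p) (yes refl)
    rewrite shiftUnit-target f (<⇒≢ p<q) = ≤-trans (case cond of λ where
      (inj₁ (1+i≡1+p , _))  → ⊥-elim (i≢p (suc-injective 1+i≡1+p))
      (inj₂ (_ , _ , drop)) → drop) (shiftUnit-≥ f {q = q} i≢p)
  by-cases (no i≢p) (no 1+i≢q) = ≤-trans (shiftUnit-≤ f {p} 1+i≢q) (≤-trans (dec i) (shiftUnit-≥ f {q = q} i≢p))

module Move {n} (a : Vec ℕ n) {p q} (move : CoverMove n a p q) where

  private
    p<q = proj₁ move
    q<n = proj₁ (proj₂ move)
    cond = proj₂ (proj₂ move)
    open ≡-Reasoning

  b : Vec ℕ n
  b = moveUnit a p q

  entry-b : ∀ i → entry b i ≡ shiftUnit (entry a) p q i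
  entry-b i with i <? n
  ... | yes i<n = entry-fromFun n _ i<n
  ... | no i≮n  = begin
    entry b i                     ≡⟨ entry-beyond b (≮⇒≥ i≮n) ⟩
    0                             ≡⟨ sym (entry-beyond a (≮⇒≥ i≮n)) ⟩
    entry a i                     ≡⟨ sym (shiftUnit-other (entry a) (outside (<-trans p<q q<n)) (outside q<n)) ⟩
    shiftUnit (entry a) p q i     ∎
    where
    outside : ∀ {m} → m < n → i ≢ m
    outside m<n refl = i≮n m<n

  source-positive : 1 ≤ entry a p
  source-positive = case cond of λ where
    (inj₁ (_ , drop))     → ≤-trans (s≤s z≤n) drop
    (inj₂ (_ , drop , _)) → ≤-trans (s≤s z≤n) drop

  psum-before : ∀ {j} → j ≤ p → psum b j ≡ psum a j
  psum-before {zero}  _   = trans (psum-zero b) (sym (psum-zero a))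
  psum-before {suc j} j<p
    rewrite psum-suc b j | psum-suc a j | entry-b j
          | shiftUnit-other (entry a) (<⇒≢ j<p) (<⇒≢ (<-trans j<p p<q)) | psum-before (<⇒≤ j<p) = refl

  psum-between : ∀ {j} → p < j → j ≤ q → suc (psum b j) ≡ psum a j
  psum-between {suc j} p<1+j 1+j≤q with m≤n⇒m<n∨m≡n (≤-pred p<1+j)
  ... | inj₂ refl = begin
    suc (psum b (suc p))                       ≡⟨ cong suc (psum-suc b p) ⟩
    suc (psum b p + entry b p)                 ≡⟨ cong (λ x → suc (x + entry b p)) (psum-before ≤-refl) ⟩
    suc (psum a p + entry b p)                 ≡⟨ cong (λ x → suc (psum a p + x)) (trans (entry-b p) (shiftUnit-source (entry a) p q)) ⟩
    suc (psum a p + pred (entry a p))          ≡⟨ sym (+-suc (psum a p) _) ⟩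
    psum a p + suc (pred (entry a p))          ≡⟨ cong (psum a p +_) (suc-pred (entry a p) {{>-nonZero source-positive}}) ⟩
    psum a p + entry a p                       ≡⟨ sym (psum-suc a p) ⟩
    psum a (suc p)                             ∎
  ... | inj₁ p<j
    rewrite psum-suc b j | psum-suc a j | entry-b j
          | shiftUnit-other (entry a) (≢-sym (<⇒≢ p<j)) (<⇒≢ 1+j≤q)
    = cong (_+ entry a j) (psum-between p<j (≤-trans (n≤1+n j) 1+j≤q))

  psum-after : ∀ {j} → q < j → psum b j ≡ psum a j
  psum-after {suc j} q<1+j with m≤n⇒m<n∨m≡n (≤-pred q<1+j)
  ... | inj₂ refl = begin
    psum b (suc q)              ≡⟨ psum-suc b q ⟩
    psum b q + entry b q        ≡⟨ cong (psum b q +_) (trans (entry-b q) (shiftUnit-target (entry a) (<⇒≢ p<q))) ⟩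
    psum b q + suc (entry a q)  ≡⟨ +-suc (psum b q) (entry a q) ⟩
    suc (psum b q) + entry a q  ≡⟨ cong (_+ entry a q) (psum-between p<q ≤-refl) ⟩
    psum a q + entry a q        ≡⟨ sym (psum-suc a q) ⟩
    psum a (suc q)              ∎
  ... | inj₁ q<j
    rewrite psum-suc b j | psum-suc a j | entry-b j
          | shiftUnit-other (entry a) (≢-sym (<⇒≢ (<-trans p<q q<j))) (≢-sym (<⇒≢ q<j)) | psum-after q<j = refl

  psum-outside : ∀ {j} → j ≤ p ⊎ q < j → psum b j ≡ psum a j
  psum-outside (inj₁ j≤p) = psum-before j≤p
  psum-outside (inj₂ q<j) = psum-after q<j

  isPartition′ : IsPartition′ n a → IsPartition′ n b
  isPartition′ (dec , psum≡n) = dec′ , trans (psum-after q<n) psum≡n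
    where
    dec′ : Decreasing (entry b)
    dec′ i rewrite entry-b i | entry-b (suc i) = shiftUnit-decreasing dec p<q cond i

  below : b ⊴ a
  below j with j ≤? p | q <? j
  ... | yes j≤p | _      = ≤-reflexive (psum-before j≤p)
  ... | no _    | yes q<j = ≤-reflexive (psum-after q<j)
  ... | no j≰p  | no q≮j  = subst (psum b j ≤_) (psum-between (≰⇒> j≰p) (≮⇒≥ q≮j)) (n≤1+n _)

  not-above : ¬ (a ⊴ b)
  not-above a⊴b = <-irrefl refl (≤-trans (≤-reflexive (psum-between ≤-refl p<q)) (a⊴b (suc p)))

  distinct : a ≢ b
  distinct a≡b = not-above (λ j → ≤-reflexive (cong (λ v → psum v j) a≡b))

psum-injective : ∀ {n} (a b : Vec ℕ n) → (∀ j → j ≤ n → psum a j ≡ psum b j) → a ≡ b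
psum-injective {n} a b same = entry-ext a b λ i i<n → +-cancelˡ-≡ (psum a i) _ _ (begin
  psum a i + entry a i   ≡⟨ sym (psum-suc a i) ⟩
  psum a (suc i)         ≡⟨ same (suc i) i<n ⟩
  psum b (suc i)         ≡⟨ psum-suc b i ⟩
  psum b i + entry b i   ≡⟨ cong (_+ entry b i) (sym (same i (<⇒≤ i<n))) ⟩
  psum a i + entry b i   ∎)
  where open ≡-Reasoning

⊴∧≢⇒strict-prefix : ∀ {n} (a b : Vec ℕ n) → b ⊴ a → a ≢ b → Σ ℕ λ j → psum b j < psum a j
⊴∧≢⇒strict-prefix {n} a b b⊴a a≢b with anyUpTo? (λ j → psum b j <? psum a j) (suc n)
... | yes (j , _ , b<a) = j , b<a
... | no ∄ = ⊥-elim (a≢b (psum-injective a b λ j j≤n →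
                 ≤-antisym (≮⇒≥ λ b<a → ∄ (j , s≤s j≤n , b<a)) (b⊴a j)))

-- The one place where the sum can exceed the bound is fenced in by bounds on both sides,
-- and a drop of at most one from a_k to a_{k+1} then rules the excess out.
psum-between-bounds : ∀ {n} (a x : Vec ℕ n) → Decreasing (entry x) → ∀ k →
                      psum a k ≤ psum x k → psum a (suc (suc k)) ≤ psum x (suc (suc k)) →
                      entry a k ≤ suc (entry a (suc k)) → psum a (suc k) ≤ psum x (suc k)
psum-between-bounds a x dec k before after small-drop
  rewrite psum-suc a (suc k) | psum-suc x (suc k) | psum-suc a k | psum-suc x k
  with suc (entry a (suc k)) ≤? entry x k
... | yes big-x = +-mono-≤ before (≤-trans small-drop big-x)
... | no small-x = +-cancelʳ-≤ (entry a (suc k)) _ _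
                     (≤-trans after (+-monoʳ-≤ _ (≤-trans (dec k) (≮⇒≥ small-x))))

module StrictRun {n} (x a : Vec ℕ n) (px : IsPartition′ n x) (pa : IsPartition′ n a) (x⊴a : x ⊴ a) where

  Strict : ℕ → Set
  Strict j = psum x j < psum a j

  StrictOn : ℕ → ℕ → Set
  StrictOn u v = ∀ j → u < j → j ≤ v → Strict j

  strict-bounded : ∀ {k} → Strict k → k ≤ n
  strict-bounded {k} strict with k ≤? n
  ... | yes k≤n = k≤n
  ... | no k≰n = ⊥-elim (<-irrefl (begin
    psum x k  ≡⟨ psum-beyond x n≤k ⟩
    psum x n  ≡⟨ trans (proj₂ px) (sym (proj₂ pa)) ⟩
    psum a n  ≡⟨ sym (psum-beyond a n≤k) ⟩
    psum a k  ∎) strict)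
    where
    open ≡-Reasoning
    n≤k = <⇒≤ (≰⇒> k≰n)

  runStart : ∀ k → Strict k → Σ ℕ λ u → u < k × StrictOn u k × psum x u ≡ psum a u
  runStart zero strict rewrite psum-zero x | psum-zero a = ⊥-elim (<-irrefl refl strict)
  runStart (suc k) strict with psum x k <? psum a k
  ... | no ¬strict = k , ≤-refl , only-1+k , ≤-antisym (x⊴a k) (≮⇒≥ ¬strict)
    where
    only-1+k : StrictOn k (suc k)
    only-1+k j k<j j≤1+k rewrite ≤-antisym j≤1+k k<j = strict
  ... | yes strict-k with runStart k strict-k
  ...   | u , u<k , strictOn , equal = u , m<n⇒m<1+n u<k , extend , equal
    where
    extend : StrictOn u (suc k)
    extend j u<j j≤1+k = case m≤n⇒m<n∨m≡n j≤1+k of λ where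
      (inj₁ j<1+k) → strictOn j u<j (≤-pred j<1+k)
      (inj₂ refl)  → strict

  runEnd : ∀ m k → m + k ≡ n → Strict k →
           Σ ℕ λ v → k ≤ v × (∀ j → k ≤ j → j ≤ v → Strict j) × psum x (suc v) ≡ psum a (suc v)
  runEnd zero k refl strict = ⊥-elim (<-irrefl (trans (proj₂ px) (sym (proj₂ pa))) strict)
  runEnd (suc m) k m+1+k≡n strict with psum x (suc k) <? psum a (suc k)
  ... | no ¬strict = k , ≤-refl , only-k , ≤-antisym (x⊴a (suc k)) (≮⇒≥ ¬strict)
    where
    only-k : ∀ j → k ≤ j → j ≤ k → Strict j
    only-k j k≤j j≤k rewrite ≤-antisym j≤k k≤j = strict
  ... | yes strict-1+k with runEnd m (suc k) (trans (+-suc m k) m+1+k≡n) strict-1+k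
  ...   | v , 1+k≤v , strictOn , equal = v , ≤-trans (n≤1+n k) 1+k≤v , extend , equal
    where
    extend : ∀ j → k ≤ j → j ≤ v → Strict j
    extend j k≤j j≤v = case m≤n⇒m<n∨m≡n k≤j of λ where
      (inj₁ k<j) → strictOn j k<j j≤v
      (inj₂ refl) → strict

  -- At the ends of a maximal run (u, v] of strict dominance a_u > x_u and a_v < x_v, and
  -- x decreases, so a_u ≥ a_v + 2.
  strictRun : ∀ k → Strict k → Σ ℕ λ u → Σ ℕ λ v → u < k × k ≤ v × StrictOn u v × suc (suc (entry a v)) ≤ entry a u
  strictRun k strict with runStart k strict | runEnd (n ∸ k) k (m∸n+n≡m (strict-bounded strict)) strict
  ... | u , u<k , strict-start , equal-u | v , k≤v , strict-end , equal-1+v = u , v , u<k , k≤v , strictOn , drop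
    where
    strictOn : StrictOn u v
    strictOn j u<j j≤v with j ≤? k
    ... | yes j≤k = strict-start j u<j j≤k
    ... | no j≰k  = strict-end j (<⇒≤ (≰⇒> j≰k)) j≤v
    gain : entry x u < entry a u
    gain = +-cancelˡ-< (psum a u) _ _ (begin-strict
      psum a u + entry x u  ≡⟨ cong (_+ entry x u) (sym equal-u) ⟩
      psum x u + entry x u  ≡⟨ sym (psum-suc x u) ⟩
      psum x (suc u)        <⟨ strict-start (suc u) ≤-refl u<k ⟩
      psum a (suc u)        ≡⟨ psum-suc a u ⟩
      psum a u + entry a u  ∎)
      where open ≤-Reasoning
    loss : entry a v < entry x v
    loss with entry a v <? entry x v
    ... | yes a<x = a<x
    ... | no a≮x = ⊥-elim (<-irrefl refl (begin-strict
      psum x (suc v)         ≡⟨ psum-suc x v ⟩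
      psum x v + entry x v   <⟨ +-mono-<-≤ (strict-end v k≤v ≤-refl) (≮⇒≥ a≮x) ⟩
      psum a v + entry a v   ≡⟨ sym (psum-suc a v) ⟩
      psum a (suc v)         ≡⟨ sym equal-1+v ⟩
      psum x (suc v)         ∎))
      where open ≤-Reasoning
    drop : suc (suc (entry a v)) ≤ entry a u
    drop = ≤-trans (s≤s loss) (≤-trans (s≤s (decreasing⇒antitone (proj₁ px) (<⇒≤ (<-≤-trans u<k k≤v)))) gain)

-- Join-irreducibility

AllDropsWithin : ∀ {n} → Vec ℕ n → ℕ → ℕ → Set
AllDropsWithin a p q = ∀ i j → suc (suc (entry a j)) ≤ entry a i → i ≤ p × q ≤ j

-- Every partition strictly below a lies below the cover c, since its run of strict
-- dominance spans a drop of a and hence all of (p, q]; so c is the unique lower cover.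
coverMove∧dropsWithin⇒joinIrreducible : ∀ {n} (a : Vec ℕ n) {p q} → IsPartition′ n a → CoverMove n a p q →
                                        AllDropsWithin a p q → JoinIrreducible n a
coverMove∧dropsWithin⇒joinIrreducible {n} a {p} {q} pa move within = not-least , split
  where
  open Move a move renaming (b to c)
  pc = isPartition′ pa

  not-least : ¬ (∀ b → IsPartition n b → a ⊴ b)
  not-least least = not-above (least c (IsPartition′⇒IsPartition c pc))

  below-c : ∀ x → IsPartition′ n x → x ⊴ a → a ≢ x → x ⊴ c
  below-c x px x⊴a a≢x j with j ≤? p | q <? j
  ... | yes j≤p | _       = subst (psum x j ≤_) (sym (psum-before j≤p)) (x⊴a j)
  ... | no _    | yes q<j = subst (psum x j ≤_) (sym (psum-after q<j)) (x⊴a j)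
  ... | no j≰p  | no q≮j
    with ⊴∧≢⇒strict-prefix a x x⊴a a≢x
  ... | k , strict with StrictRun.strictRun x a px pa x⊴a k strict
  ... | u , v , _ , _ , strictOn , drop with within u v drop
  ... | u≤p , q≤v = ≤-pred (subst (psum x j <_) (sym (psum-between (≰⇒> j≰p) (≮⇒≥ q≮j)))
                             (strictOn j (<-≤-trans (s≤s u≤p) (≰⇒> j≰p)) (≤-trans (≮⇒≥ q≮j) q≤v)))

  split : ∀ b b′ → IsPartition n b → IsPartition n b′ → IsJoin n a b b′ → (a ≡ b) ⊎ (a ≡ b′)
  split b b′ ib ib′ (b⊴a , b′⊴a , least-upper) with ≡-dec _≟_ a b | ≡-dec _≟_ a b′
  ... | yes a≡b | _        = inj₁ a≡b
  ... | no _    | yes a≡b′ = inj₂ a≡b′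
  ... | no a≢b  | no a≢b′  = ⊥-elim (not-above (least-upper c (IsPartition′⇒IsPartition c pc)
                               (below-c b (IsPartition⇒IsPartition′ b ib) b⊴a a≢b)
                               (below-c b′ (IsPartition⇒IsPartition′ b′ ib′) b′⊴a a≢b′)))

-- The two lower covers have a as their join: every index lies outside one of the two
-- moved ranges, except possibly q₁ = p₂ + 1, which psum-between-bounds handles.
twoCoverMoves⇒¬joinIrreducible : ∀ {n} (a : Vec ℕ n) {p₁ q₁ p₂ q₂} → IsPartition′ n a →
                                 CoverMove n a p₁ q₁ → CoverMove n a p₂ q₂ → q₁ ≤ suc p₂ →
                                 (q₁ ≡ suc p₂ → entry a p₂ ≤ suc (entry a q₁)) → ¬ JoinIrreducible n a
twoCoverMoves⇒¬joinIrreducible {n} a {p₁} {q₁} {p₂} {q₂} pa move₁ move₂ q₁≤1+p₂ small-drop (_ , split)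
  with split c₁ c₂ (IsPartition′⇒IsPartition c₁ (M₁.isPartition′ pa)) (IsPartition′⇒IsPartition c₂ (M₂.isPartition′ pa))
             (M₁.below , M₂.below , least-upper)
  where
  module M₁ = Move a move₁
  module M₂ = Move a move₂
  c₁ = M₁.b
  c₂ = M₂.b

  via₁ : ∀ d → c₁ ⊴ d → ∀ {j} → j ≤ p₁ ⊎ q₁ < j → psum a j ≤ psum d j
  via₁ d c₁⊴d {j} outside = subst (_≤ psum d j) (M₁.psum-outside outside) (c₁⊴d j)

  via₂ : ∀ d → c₂ ⊴ d → ∀ {j} → j ≤ p₂ ⊎ q₂ < j → psum a j ≤ psum d j
  via₂ d c₂⊴d {j} outside = subst (_≤ psum d j) (M₂.psum-outside outside) (c₂⊴d j)

  least-upper : ∀ d → IsPartition n d → c₁ ⊴ d → c₂ ⊴ d → a ⊴ d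
  least-upper d pd c₁⊴d c₂⊴d j with j ≤? p₁ | q₁ <? j | j ≤? p₂ | q₂ <? j
  ... | yes j≤p₁ | _        | _        | _        = via₁ d c₁⊴d (inj₁ j≤p₁)
  ... | no _     | yes q₁<j | _        | _        = via₁ d c₁⊴d (inj₂ q₁<j)
  ... | no _     | no _     | yes j≤p₂ | _        = via₂ d c₂⊴d (inj₁ j≤p₂)
  ... | no _     | no _     | no _     | yes q₂<j = via₂ d c₂⊴d (inj₂ q₂<j)
  ... | no _     | no q₁≮j  | no j≰p₂  | no _     =
    subst (λ i → psum a i ≤ psum d i) (sym j≡1+p₂)
      (psum-between-bounds a d (proj₁ (IsPartition⇒IsPartition′ d pd)) p₂
        (via₂ d c₂⊴d (inj₁ ≤-refl)) (via₁ d c₁⊴d (inj₂ (s≤s q₁≤1+p₂))) small-drop′)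
    where
    j≡1+p₂ : j ≡ suc p₂
    j≡1+p₂ = ≤-antisym (≤-trans (≮⇒≥ q₁≮j) q₁≤1+p₂) (≰⇒> j≰p₂)
    q₁≡1+p₂ : q₁ ≡ suc p₂
    q₁≡1+p₂ = ≤-antisym q₁≤1+p₂ (subst (_≤ q₁) j≡1+p₂ (≮⇒≥ q₁≮j))
    small-drop′ : entry a p₂ ≤ suc (entry a (suc p₂))
    small-drop′ = subst (λ i → entry a p₂ ≤ suc (entry a i)) q₁≡1+p₂ (small-drop q₁≡1+p₂)
... | inj₁ a≡c₁ = Move.distinct a move₁ a≡c₁
... | inj₂ a≡c₂ = Move.distinct a move₂ a≡c₂

psum-≤-length : ∀ {n} (a : Vec ℕ n) → Decreasing (entry a) → entry a 0 ≤ 1 → ∀ j → psum a j ≤ j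
psum-≤-length a dec a₀≤1 zero rewrite psum-zero a = z≤n
psum-≤-length a dec a₀≤1 (suc j) rewrite psum-suc a j | +-comm (psum a j) (entry a j) =
  +-mono-≤ (≤-trans (decreasing⇒antitone dec z≤n) a₀≤1) (psum-≤-length a dec a₀≤1 j)

psum-constant-after-zero : ∀ {n} (b : Vec ℕ n) → Decreasing (entry b) → ∀ {i} → entry b i ≡ 0 →
                           ∀ {j} → i ≤ j → psum b j ≡ psum b i
psum-constant-after-zero b dec bᵢ≡0 {j} i≤j with m≤n⇒m<n∨m≡n i≤j
psum-constant-after-zero b dec bᵢ≡0 {j} i≤j     | inj₂ refl = refl
psum-constant-after-zero b dec bᵢ≡0 {suc j} i≤j | inj₁ (s≤s i≤j′)
  rewrite psum-suc b j | n≤0⇒n≡0 (≤-trans (decreasing⇒antitone dec i≤j′) (≤-reflexive bᵢ≡0)) | +-identityʳ (psum b j)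
  = psum-constant-after-zero b dec bᵢ≡0 i≤j′

length-≤-psum : ∀ {n} (b : Vec ℕ n) → IsPartition′ n b → ∀ {j} → j ≤ n → j ≤ psum b j
length-≤-psum b pb {zero}  _ = z≤n
length-≤-psum {n} b (dec , psum≡n) {suc j} j<n with entry b j ≟ 0
... | yes bⱼ≡0 = subst (suc j ≤_) (begin
  n               ≡⟨ sym psum≡n ⟩
  psum b n        ≡⟨ psum-constant-after-zero b dec bⱼ≡0 (<⇒≤ j<n) ⟩
  psum b j        ≡⟨ sym (psum-constant-after-zero b dec bⱼ≡0 (n≤1+n j)) ⟩
  psum b (suc j)  ∎) j<n
  where open ≡-Reasoning
... | no bⱼ≢0 rewrite psum-suc b j | +-comm (psum b j) (entry b j) =
  +-mono-≤ (n≢0⇒n>0 bⱼ≢0) (length-≤-psum b (dec , psum≡n) (<⇒≤ j<n))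

first≤1⇒least : ∀ {n} (a : Vec ℕ n) → IsPartition′ n a → entry a 0 ≤ 1 → ∀ b → IsPartition′ n b → a ⊴ b
first≤1⇒least {n} a (dec , psum≡n) a₀≤1 b pb j with j ≤? n
... | yes j≤n = ≤-trans (psum-≤-length a dec a₀≤1 j) (length-≤-psum b pb j≤n)
... | no j≰n  = ≤-reflexive (begin
  psum a j  ≡⟨ psum-beyond a n≤j ⟩
  psum a n  ≡⟨ trans psum≡n (sym (proj₂ pb)) ⟩
  psum b n  ≡⟨ sym (psum-beyond b n≤j) ⟩
  psum b j  ∎)
  where
  open ≡-Reasoning
  n≤j = <⇒≤ (≰⇒> j≰n)

-- Block partitions (y+1)^r y^(k−r) 1^(t−k) 0^(n−t)

indicator : ℕ → ℕ → ℕ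
indicator r i with i <? r
... | yes _ = 1
... | no _  = 0

indicator-below : ∀ {r i} → i < r → indicator r i ≡ 1
indicator-below {r} {i} i<r with i <? r
... | yes _  = refl
... | no i≮r = ⊥-elim (i≮r i<r)

indicator-above : ∀ {r i} → r ≤ i → indicator r i ≡ 0
indicator-above {r} {i} r≤i with i <? r
... | yes i<r = ⊥-elim (<-irrefl refl (≤-trans i<r r≤i))
... | no _    = refl

indicator-decreasing : ∀ r → Decreasing (indicator r)
indicator-decreasing r i = case suc i <? r of λ where
  (yes 1+i<r) → ≤-reflexive (trans (indicator-below 1+i<r) (sym (indicator-below (<-trans (n<1+n i) 1+i<r))))
  (no 1+i≮r)  → subst (_≤ indicator r i) (sym (indicator-above (≮⇒≥ 1+i≮r))) z≤n

sumBelow-indicator : ∀ r j → sumBelow (indicator r) j ≡ j ⊓ r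
sumBelow-indicator r zero = refl
sumBelow-indicator r (suc j) with j <? r
... | yes j<r rewrite sumBelow-indicator r j | m≤n⇒m⊓n≡m (<⇒≤ j<r) | m≤n⇒m⊓n≡m j<r = +-comm j 1
... | no j≮r  rewrite sumBelow-indicator r j | m≥n⇒m⊓n≡n (≮⇒≥ j≮r) | m≥n⇒m⊓n≡n (≤-trans (≮⇒≥ j≮r) (n≤1+n j)) = +-identityʳ r

sumBelow-+ : ∀ f g j → sumBelow (λ i → f i + g i) j ≡ sumBelow f j + sumBelow g j
sumBelow-+ f g zero    = refl
sumBelow-+ f g (suc j) rewrite sumBelow-+ f g j = interchange (sumBelow f j) (sumBelow g j) (f j) (g j)

sumBelow-* : ∀ c f j → sumBelow (λ i → c * f i) j ≡ c * sumBelow f j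
sumBelow-* c f zero    = sym (*-zeroʳ c)
sumBelow-* c f (suc j) rewrite sumBelow-* c f j = sym (*-distribˡ-+ c (sumBelow f j) (f j))

blockFun : ℕ → ℕ → ℕ → ℕ → ℕ → ℕ
blockFun r k t y i = indicator r i + pred y * indicator k i + indicator t i

block : (n r k t y : ℕ) → Vec ℕ n
block n r k t y = fromFun n (blockFun r k t y)

sumBelow-blockFun : ∀ r k t y j → sumBelow (blockFun r k t y) j ≡ j ⊓ r + pred y * (j ⊓ k) + j ⊓ t
sumBelow-blockFun r k t y j
  rewrite sumBelow-+ (λ i → indicator r i + pred y * indicator k i) (indicator t) j
        | sumBelow-+ (indicator r) (λ i → pred y * indicator k i) j
        | sumBelow-* (pred y) (indicator k) j
        | sumBelow-indicator r j | sumBelow-indicator k j | sumBelow-indicator t j = refl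

blockFun-decreasing : ∀ r k t y → Decreasing (blockFun r k t y)
blockFun-decreasing r k t y i =
  +-mono-≤ (+-mono-≤ (indicator-decreasing r i) (*-monoʳ-≤ (pred y) (indicator-decreasing k i))) (indicator-decreasing t i)

module Block (n r k t y : ℕ) (r<k : r < k) (k≤t : k ≤ t) (t≤n : t ≤ n) (2≤y : 2 ≤ y) where

  a : Vec ℕ n
  a = block n r k t y

  private
    f = blockFun r k t y
    pred-y+1 : pred y + 1 ≡ y
    pred-y+1 = trans (+-comm (pred y) 1) (suc-pred y {{>-nonZero (≤-trans (s≤s z≤n) 2≤y)}})

  blockFun-tail : ∀ i → t ≤ i → f i ≡ 0
  blockFun-tail i t≤i
    rewrite indicator-above (≤-trans (<⇒≤ r<k) (≤-trans k≤t t≤i)) | indicator-above (≤-trans k≤t t≤i)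
          | indicator-above t≤i | *-zeroʳ (pred y) = refl

  entry-a : ∀ i → entry a i ≡ f i
  entry-a i with i <? n
  ... | yes i<n = entry-fromFun n f i<n
  ... | no i≮n  = trans (entry-beyond a (≮⇒≥ i≮n)) (sym (blockFun-tail i (≤-trans t≤n (≮⇒≥ i≮n))))

  entry-head : ∀ i → i < r → entry a i ≡ suc y
  entry-head i i<r
    rewrite entry-a i | indicator-below i<r | indicator-below (<-trans i<r r<k)
          | indicator-below (<-≤-trans (<-trans i<r r<k) k≤t) | *-identityʳ (pred y)
    = cong suc pred-y+1

  entry-body : ∀ i → r ≤ i → i < k → entry a i ≡ y
  entry-body i r≤i i<k
    rewrite entry-a i | indicator-above r≤i | indicator-below i<k | indicator-below (<-≤-trans i<k k≤t)
          | *-identityʳ (pred y) = pred-y+1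

  entry-ones : ∀ i → k ≤ i → i < t → entry a i ≡ 1
  entry-ones i k≤i i<t
    rewrite entry-a i | indicator-above (≤-trans (<⇒≤ r<k) k≤i) | indicator-above k≤i | indicator-below i<t
          | *-zeroʳ (pred y) = refl

  entry-tail : ∀ i → t ≤ i → entry a i ≡ 0
  entry-tail i t≤i = trans (entry-a i) (blockFun-tail i t≤i)

  psum-a : ∀ j → j ≤ n → psum a j ≡ j ⊓ r + pred y * (j ⊓ k) + j ⊓ t
  psum-a j j≤n = trans (psum-fromFun n f j≤n) (sumBelow-blockFun r k t y j)

  psum-total : psum a n ≡ r + pred y * k + t
  psum-total = begin
    psum a n                                ≡⟨ psum-a n ≤-refl ⟩
    n ⊓ r + pred y * (n ⊓ k) + n ⊓ t        ≡⟨ cong₂ (λ u v → u + pred y * v + n ⊓ t) (m≥n⇒m⊓n≡n r≤n) (m≥n⇒m⊓n≡n k≤n) ⟩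
    r + pred y * k + n ⊓ t                  ≡⟨ cong (r + pred y * k +_) (m≥n⇒m⊓n≡n t≤n) ⟩
    r + pred y * k + t                      ∎
    where
    open ≡-Reasoning
    k≤n = ≤-trans k≤t t≤n
    r≤n = ≤-trans (<⇒≤ r<k) k≤n

  isPartition′ : r + pred y * k + t ≡ n → IsPartition′ n a
  isPartition′ size≡n = decreasing , trans psum-total size≡n
    where
    decreasing : Decreasing (entry a)
    decreasing i rewrite entry-a i | entry-a (suc i) = blockFun-decreasing r k t y i

  entry-≤ : ∀ i → entry a i ≤ suc y
  entry-≤ i with i <? r | i <? k | i <? t
  ... | yes i<r | _       | _       = ≤-reflexive (entry-head i i<r)
  ... | no i≮r  | yes i<k | _       = ≤-trans (≤-reflexive (entry-body i (≮⇒≥ i≮r) i<k)) (n≤1+n y)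
  ... | no _    | no i≮k  | yes i<t = ≤-trans (≤-reflexive (entry-ones i (≮⇒≥ i≮k) i<t)) (s≤s z≤n)
  ... | no _    | no _    | no i≮t  = ≤-trans (≤-reflexive (entry-tail i (≮⇒≥ i≮t))) z≤n

  entry-≥-before-k : ∀ i → i < k → y ≤ entry a i
  entry-≥-before-k i i<k with i <? r
  ... | yes i<r = ≤-trans (n≤1+n y) (≤-reflexive (sym (entry-head i i<r)))
  ... | no i≮r  = ≤-reflexive (sym (entry-body i (≮⇒≥ i≮r) i<k))

  entry-≤-from-k : ∀ i → k ≤ i → entry a i ≤ 1
  entry-≤-from-k i k≤i with i <? t
  ... | yes i<t = ≤-reflexive (entry-ones i k≤i i<t)
  ... | no i≮t  = ≤-trans (≤-reflexive (entry-tail i (≮⇒≥ i≮t))) z≤n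

  entry-positive : ∀ i → i < t → 1 ≤ entry a i
  entry-positive i i<t with i <? k
  ... | yes i<k = ≤-trans (≤-trans (s≤s z≤n) 2≤y) (entry-≥-before-k i i<k)
  ... | no i≮k  = ≤-reflexive (sym (entry-ones i (≮⇒≥ i≮k) i<t))

  drop-starts-before-k : ∀ {i j} → suc (suc (entry a j)) ≤ entry a i → i < k
  drop-starts-before-k {i} {j} drop with i <? k
  ... | yes i<k = i<k
  ... | no i≮k  = ⊥-elim (<-irrefl refl (≤-trans (s≤s (s≤s z≤n)) (≤-trans drop (entry-≤-from-k i (≮⇒≥ i≮k)))))

  drop-ends-from-k : ∀ {i j} → suc (suc (entry a j)) ≤ entry a i → k ≤ j
  drop-ends-from-k {i} {j} drop with k ≤? j
  ... | yes k≤j = k≤j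
  ... | no k≰j  = ⊥-elim (<-irrefl refl (≤-trans (s≤s (s≤s (entry-≥-before-k j (≰⇒> k≰j)))) (≤-trans drop (entry-≤ i))))

-- The join-irreducible blocks: no ones, a drop of at least two onto the ones, or 2^k 1^(t−k)
-- followed by at least one zero.
BlockJI : ℕ → ℕ → ℕ → ℕ → ℕ → Set
BlockJI n r k t y = (t ≡ k × k < n) ⊎ (k < t × 3 ≤ y) ⊎ (k < t × t < n × y ≡ 2 × r ≡ 0)

block-joinIrreducible : ∀ n r k′ t y (r<k : r < suc k′) (k≤t : suc k′ ≤ t) (t≤n : t ≤ n) (2≤y : 2 ≤ y) →
                        IsPartition′ n (block n r (suc k′) t y) → BlockJI n r (suc k′) t y →
                        JoinIrreducible n (block n r (suc k′) t y)
block-joinIrreducible n r k′ t y r<k k≤t t≤n 2≤y pa = λ where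
    (inj₁ (refl , k<n))              → single-step k<n (subst (λ e → suc (suc e) ≤ y) (sym (entry-tail (suc k′) ≤-refl)) 2≤y)
    (inj₂ (inj₁ (k<t , 3≤y)))        → single-step (<-≤-trans k<t t≤n) (subst (λ e → suc (suc e) ≤ y) (sym (entry-ones (suc k′) ≤-refl k<t)) 3≤y)
    (inj₂ (inj₂ (k<t , t<n , y≡2 , r≡0))) → long-step k<t t<n y≡2 r≡0
  where
  open Block n r (suc k′) t y r<k k≤t t≤n 2≤y

  entry-k′ : entry a k′ ≡ y
  entry-k′ = entry-body k′ (≤-pred r<k) ≤-refl

  single-step : suc k′ < n → suc (suc (entry a (suc k′))) ≤ y → JoinIrreducible n a
  single-step k<n drop = coverMove∧dropsWithin⇒joinIrreducible a pa
    (≤-refl , k<n , inj₁ (refl , subst (suc (suc (entry a (suc k′))) ≤_) (sym entry-k′) drop))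
    (λ i j drop → ≤-pred (drop-starts-before-k drop) , drop-ends-from-k drop)

  long-step : suc k′ < t → t < n → y ≡ 2 → r ≡ 0 → JoinIrreducible n a
  long-step k<t t<n refl r≡0 = coverMove∧dropsWithin⇒joinIrreducible a pa
    (k≤t , t<n , inj₂ (k<t , k-drop , t-drop))
    (λ i j drop → ≤-pred (drop-starts-before-k drop) , drops-end-from-t drop)
    where
    k-drop : suc (entry a (suc k′)) ≤ entry a k′
    k-drop rewrite entry-ones (suc k′) ≤-refl k<t | entry-k′ = ≤-refl
    t-drop : suc (entry a t) ≤ entry a (pred t)
    t-drop rewrite entry-tail t ≤-refl = entry-positive (pred t) (pred[m]<m (<-≤-trans (s≤s z≤n) k≤t))
    entry-≤2 : ∀ i → entry a i ≤ 2
    entry-≤2 i with i <? suc k′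
    ... | yes i<k = ≤-reflexive (entry-body i (subst (_≤ i) (sym r≡0) z≤n) i<k)
    ... | no i≮k  = ≤-trans (entry-≤-from-k i (≮⇒≥ i≮k)) (s≤s z≤n)
    drops-end-from-t : ∀ {i j} → suc (suc (entry a j)) ≤ entry a i → t ≤ j
    drops-end-from-t {i} {j} drop with t ≤? j
    ... | yes t≤j = t≤j
    ... | no t≰j  = ⊥-elim (<-irrefl refl (≤-trans (s≤s (s≤s (entry-positive j (≰⇒> t≰j)))) (≤-trans drop (entry-≤2 i))))

-- With r ≥ 1 the block 3^r 2^(k−r) 1^(t−k) has the two lower covers obtained by moving
-- a unit from row r − 1 to row k and from row k − 1 to row t; their join is the block itself.
block-¬joinIrreducible : ∀ {n r k t y} (r<k : r < k) (k≤t : k ≤ t) (t≤n : t ≤ n) (2≤y : 2 ≤ y) →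
                         1 ≤ r → k < t → t < n → y ≡ 2 →
                         IsPartition′ n (block n r k t y) → ¬ JoinIrreducible n (block n r k t y)
block-¬joinIrreducible {n} {suc r′} {suc k′} {t} r<k k≤t t≤n 2≤y (s≤s _) k<t t<n refl pa =
  twoCoverMoves⇒¬joinIrreducible a pa
    (<-trans (n<1+n r′) r<k , <-trans k<t t<n , inj₂ (r<k , r-drop , k-drop))
    (k≤t , t<n , inj₂ (k<t , k-drop , t-drop))
    ≤-refl (λ _ → ≤-reflexive (trans (entry-body k′ (≤-pred r<k) ≤-refl) (cong suc (sym (entry-ones (suc k′) ≤-refl k<t)))))
  where
  open Block n (suc r′) (suc k′) t 2 r<k k≤t t≤n 2≤y
  r-drop : suc (entry a (suc r′)) ≤ entry a r′
  r-drop rewrite entry-body (suc r′) ≤-refl r<k | entry-head r′ ≤-refl = ≤-refl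
  k-drop : suc (entry a (suc k′)) ≤ entry a k′
  k-drop rewrite entry-ones (suc k′) ≤-refl k<t | entry-body k′ (≤-pred r<k) ≤-refl = ≤-refl
  t-drop : suc (entry a t) ≤ entry a (pred t)
  t-drop rewrite entry-tail t ≤-refl = entry-positive (pred t) (pred[m]<m (<-≤-trans (s≤s z≤n) k≤t))

r+pred[y]*k+k≡r+y*k : ∀ r k {y} → 1 ≤ y → r + pred y * k + k ≡ r + y * k
r+pred[y]*k+k≡r+y*k r k {suc y} _ = trans (+-assoc r (y * k) k) (cong (r +_) (+-comm (y * k) k))

[r+y*k]/k≡y : ∀ {r k} y .{{_ : NonZero k}} → r < k → (r + y * k) / k ≡ y
[r+y*k]/k≡y {r} {k} y r<k = *-cancelʳ-≡ _ y k (+-cancelˡ-≡ r _ _ (begin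
  r + (r + y * k) / k * k                  ≡⟨ cong (_+ (r + y * k) / k * k) (sym [r+y*k]%k≡r) ⟩
  (r + y * k) % k + (r + y * k) / k * k    ≡⟨ sym (m≡m%n+[m/n]*n (r + y * k) k) ⟩
  r + y * k                                ∎))
  where
  open ≡-Reasoning
  [r+y*k]%k≡r = trans ([m+kn]%n≡m%n r y k) (m<n⇒m%n≡m r<k)

*≤⇒≤/ : ∀ c {k s} .{{_ : NonZero k}} → c * k ≤ s → c ≤ s / k
*≤⇒≤/ c {k} c*k≤s = subst (_≤ _) (m*n/n≡m c k) (/-monoˡ-≤ k c*k≤s)

-- A join-irreducible partition of n is determined by the number k′ + 1 of its parts that
-- exceed 1 and their sum s: these parts are as equal as possible, and n − s ones follow.
Admissible : ℕ → ℕ → ℕ → Set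
Admissible n k′ s = 2 * suc k′ ≤ s × s ≤ n × (s ≡ n ⊎ 3 * suc k′ ≤ s ⊎ s ≡ 2 * suc k′)

realise : (n k′ s : ℕ) → Vec ℕ n
realise n k′ s = block n (s % suc k′) (suc k′) (suc k′ + (n ∸ s)) (s / suc k′)

module Realise {n k′ s : ℕ} (adm : Admissible n k′ s) where

  k r y t : ℕ
  k = suc k′
  r = s % k
  y = s / k
  t = k + (n ∸ s)

  private
    2k≤s = proj₁ adm
    s≤n = proj₁ (proj₂ adm)
    k<2k : k < 2 * k
    k<2k = m<m+n k (s≤s z≤n)
    s+[n∸s]≡n : s + (n ∸ s) ≡ n
    s+[n∸s]≡n = m+[n∸m]≡n s≤n

  r<k : r < k
  r<k = m%n<n s k

  k≤t : k ≤ t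
  k≤t = m≤m+n k (n ∸ s)

  t≤n : t ≤ n
  t≤n = subst (t ≤_) s+[n∸s]≡n (+-monoˡ-≤ (n ∸ s) (≤-trans (<⇒≤ k<2k) 2k≤s))

  2≤y : 2 ≤ y
  2≤y = *≤⇒≤/ 2 2k≤s

  open Block n r k t y r<k k≤t t≤n 2≤y public

  s≡r+y*k : s ≡ r + y * k
  s≡r+y*k = m≡m%n+[m/n]*n s k

  r+pred[y]*k+k≡s : r + pred y * k + k ≡ s
  r+pred[y]*k+k≡s = trans (r+pred[y]*k+k≡r+y*k r k (≤-trans (s≤s z≤n) 2≤y)) (sym s≡r+y*k)

  realise-isPartition′ : IsPartition′ n (realise n k′ s)
  realise-isPartition′ = isPartition′ (begin
    r + pred y * k + (k + (n ∸ s))   ≡⟨ sym (+-assoc (r + pred y * k) k (n ∸ s)) ⟩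
    r + pred y * k + k + (n ∸ s)     ≡⟨ cong (_+ (n ∸ s)) r+pred[y]*k+k≡s ⟩
    s + (n ∸ s)                      ≡⟨ s+[n∸s]≡n ⟩
    n                                ∎)
    where open ≡-Reasoning

  psum-k : psum (realise n k′ s) k ≡ s
  psum-k = begin
    psum a k                                  ≡⟨ psum-a k (≤-trans k≤t t≤n) ⟩
    k ⊓ r + pred y * (k ⊓ k) + k ⊓ t          ≡⟨ cong₂ (λ u v → u + pred y * v + k ⊓ t) (m≥n⇒m⊓n≡n (<⇒≤ r<k)) (⊓-idem k) ⟩
    r + pred y * k + k ⊓ t                    ≡⟨ cong (r + pred y * k +_) (m≤n⇒m⊓n≡m k≤t) ⟩
    r + pred y * k + k                        ≡⟨ r+pred[y]*k+k≡s ⟩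
    s                                         ∎
    where open ≡-Reasoning

  blockJI : BlockJI n r k t y
  blockJI with s ≟ n
  ... | yes refl = inj₁ (trans (cong (k +_) (n∸n≡0 s)) (+-identityʳ k) , <-≤-trans k<2k 2k≤s)
  ... | no s≢n with proj₂ (proj₂ adm)
  ...   | inj₁ s≡n          = ⊥-elim (s≢n s≡n)
  ...   | inj₂ (inj₁ 3k≤s)  = inj₂ (inj₁ (k<t , *≤⇒≤/ 3 3k≤s))
    where k<t = subst (_< t) (+-identityʳ k) (+-monoʳ-< k (m<n⇒0<n∸m (≤∧≢⇒< s≤n s≢n)))
  ...   | inj₂ (inj₂ refl)  = inj₂ (inj₂ (k<t , t<n , m*n/n≡m 2 k , m*n%n≡0 2 k))
    where
    k<t = subst (_< t) (+-identityʳ k) (+-monoʳ-< k (m<n⇒0<n∸m (≤∧≢⇒< s≤n s≢n)))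
    t<n = subst (t <_) s+[n∸s]≡n (+-monoˡ-< (n ∸ s) k<2k)

  joinIrreducible : JoinIrreducible n (realise n k′ s)
  joinIrreducible = block-joinIrreducible n r k′ t y r<k k≤t t≤n 2≤y realise-isPartition′ blockJI

realise-≢-more-parts : ∀ {n k s k′ s′} → Admissible n k s → Admissible n k′ s′ → k′ < k →
                      realise n k s ≢ realise n k′ s′
realise-≢-more-parts {n} {k} {s} {k′} {s′} adm adm′ k′<k same = <-irrefl refl (begin-strict
  1                                <⟨ R.2≤y ⟩
  R.y                              ≤⟨ R.entry-≥-before-k (suc k′) (s≤s k′<k) ⟩
  entry (realise n k s) (suc k′)   ≡⟨ cong (λ v → entry v (suc k′)) same ⟩
  entry (realise n k′ s′) (suc k′) ≤⟨ R′.entry-≤-from-k (suc k′) ≤-refl ⟩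
  1                                ∎)
  where
  open ≤-Reasoning
  module R = Realise adm
  module R′ = Realise adm′

realise-injective : ∀ {n k₁ s₁ k₂ s₂} → Admissible n k₁ s₁ → Admissible n k₂ s₂ →
                    realise n k₁ s₁ ≡ realise n k₂ s₂ → (k₁ , s₁) ≡ (k₂ , s₂)
realise-injective {n} {k₁} {s₁} {k₂} {s₂} adm₁ adm₂ same with <-cmp k₁ k₂
... | tri< k₁<k₂ _ _ = ⊥-elim (realise-≢-more-parts adm₂ adm₁ k₁<k₂ (sym same))
... | tri> _ _ k₂<k₁ = ⊥-elim (realise-≢-more-parts adm₁ adm₂ k₂<k₁ same)
... | tri≈ _ refl _ = cong (k₁ ,_) (begin
  s₁                    ≡⟨ sym (Realise.psum-k adm₁) ⟩
  psum (realise n k₁ s₁) (suc k₁)  ≡⟨ cong (λ v → psum v (suc k₁)) same ⟩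
  psum (realise n k₁ s₂) (suc k₁)  ≡⟨ Realise.psum-k adm₂ ⟩
  s₂                    ∎)
  where open ≡-Reasoning

-- Reconstruction of join-irreducible partitions

-- q is the first index past the plateau that starts at i + 1.
coverMove-after-step : ∀ {n} (a : Vec ℕ n) → Decreasing (entry a) → ∀ {i j} → j < n →
                       entry a (suc i) < entry a i → entry a j < entry a (suc i) →
                       Σ ℕ λ q → q ≤ j × CoverMove n a i q
coverMove-after-step a dec {i} {j} j<n step below-plateau
  with leastUpTo (λ m → entry a m <? entry a (suc i)) {j} below-plateau
... | q , q≤j , below , earlier-not-below = q , q≤j , <-trans (n<1+n i) 1+i<q , ≤-<-trans q≤j j<n ,
        inj₂ (1+i<q , step , ≤-trans below (≮⇒≥ (earlier-not-below (pred q) (pred[m]<m (<-trans (s≤s z≤n) 1+i<q)))))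
  where
  1+i<q : suc i < q
  1+i<q = ≰⇒> λ q≤1+i → <-irrefl refl (<-≤-trans below (decreasing⇒antitone dec q≤1+i))

coverMove-within-drop : ∀ {n} (a : Vec ℕ n) → Decreasing (entry a) → ∀ d {i j} → i + d ≡ j → j < n →
                        suc (suc (entry a j)) ≤ entry a i → Σ ℕ λ p → Σ ℕ λ q → i ≤ p × q ≤ j × CoverMove n a p q
coverMove-within-drop a dec zero {i} refl j<n drop rewrite +-identityʳ i = ⊥-elim (<-irrefl refl (≤-trans (s≤s (n≤1+n _)) drop))
coverMove-within-drop {n} a dec (suc d) {i} {j} i+1+d≡j j<n drop
  with suc (suc (entry a (suc i))) ≤? entry a i | entry a (suc i) <? entry a i
... | yes big-step | _ = i , suc i , ≤-refl , 1+i≤j , ≤-refl , <-≤-trans (s≤s 1+i≤j) j<n , inj₁ (refl , big-step)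
  where 1+i≤j = subst (suc i ≤_) (trans (sym (+-suc i d)) i+1+d≡j) (s≤s (m≤m+n i d))
... | no small-step | yes step =
  let q , q≤j , move = coverMove-after-step a dec j<n step (≤-pred (≤-trans drop (≮⇒≥ small-step)))
  in i , q , ≤-refl , q≤j , move
... | no _ | no plateau
  with coverMove-within-drop a dec d (trans (sym (+-suc i d)) i+1+d≡j) j<n
         (subst (suc (suc (entry a j)) ≤_) (≤-antisym (≮⇒≥ plateau) (dec i)) drop)
...   | p , q , 1+i≤p , q≤j , move = p , q , ≤-trans (n≤1+n i) 1+i≤p , q≤j , move

psum-≥-positive-prefix : ∀ {n} (a : Vec ℕ n) → 2 ≤ entry a 0 → ∀ {j} → (∀ i → i < j → 1 ≤ entry a i) → 1 ≤ j →
                         suc j ≤ psum a j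
psum-≥-positive-prefix a 2≤a₀ {suc zero} _ _ = subst (2 ≤_) (sym (trans (psum-suc a 0) (cong (_+ entry a 0) (psum-zero a)))) 2≤a₀
psum-≥-positive-prefix a 2≤a₀ {suc (suc j)} positive _ = begin
  suc (suc (suc j))                ≡⟨ +-comm 1 (suc (suc j)) ⟩
  suc (suc j) + 1                  ≤⟨ +-mono-≤ (psum-≥-positive-prefix a 2≤a₀ {suc j} (λ i i<1+j → positive i (m<n⇒m<1+n i<1+j)) (s≤s z≤n))
                                               (positive (suc j) ≤-refl) ⟩
  psum a (suc j) + entry a (suc j) ≡⟨ sym (psum-suc a (suc j)) ⟩
  psum a (suc (suc j))             ∎
  where open ≤-Reasoning

module Reconstruct {n} (a : Vec ℕ n) (pa : IsPartition′ n a) (ji : JoinIrreducible n a) where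

  private
    dec = proj₁ pa
    antitone = decreasing⇒antitone dec

  2≤a₀ : 2 ≤ entry a 0
  2≤a₀ with 2 ≤? entry a 0
  ... | yes 2≤a₀ = 2≤a₀
  ... | no 2≰a₀  = ⊥-elim (proj₁ ji λ b pb → first≤1⇒least a pa (≤-pred (≰⇒> 2≰a₀)) b (IsPartition⇒IsPartition′ b pb))

  private opaque
    first-zero : Σ ℕ λ t → t ≤ n × entry a t ≡ 0 × (∀ i → i < t → entry a i ≢ 0)
    first-zero = leastUpTo (λ m → entry a m ≟ 0) (entry-beyond a ≤-refl)

  t : ℕ
  t = proj₁ first-zero

  t≤n : t ≤ n
  t≤n = proj₁ (proj₂ first-zero)

  entry-t : entry a t ≡ 0
  entry-t = proj₁ (proj₂ (proj₂ first-zero))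

  positive-before-t : ∀ i → i < t → 1 ≤ entry a i
  positive-before-t i i<t = n≢0⇒n>0 (proj₂ (proj₂ (proj₂ first-zero)) i i<t)

  1≤t : 1 ≤ t
  1≤t = n≢0⇒n>0 λ t≡0 → <-irrefl refl (≤-trans (<⇒≤ 2≤a₀) (≤-reflexive (trans (cong (entry a) (sym t≡0)) entry-t)))

  t<n : t < n
  t<n = ≤∧≢⇒< t≤n λ t≡n → <-irrefl (sym (proj₂ pa))
          (subst (λ m → suc m ≤ psum a m) t≡n (psum-≥-positive-prefix a 2≤a₀ positive-before-t 1≤t))

  private opaque
    first-≤1 : Σ ℕ λ k → k ≤ t × entry a k ≤ 1 × (∀ i → i < k → ¬ entry a i ≤ 1)
    first-≤1 = leastUpTo (λ m → entry a m ≤? 1) (≤-trans (≤-reflexive entry-t) z≤n)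

  k : ℕ
  k = proj₁ first-≤1

  k≤t : k ≤ t
  k≤t = proj₁ (proj₂ first-≤1)

  entry-k≤1 : entry a k ≤ 1
  entry-k≤1 = proj₁ (proj₂ (proj₂ first-≤1))

  2≤before-k : ∀ i → i < k → 2 ≤ entry a i
  2≤before-k i i<k = ≰⇒> (proj₂ (proj₂ (proj₂ first-≤1)) i i<k)

  1≤k : 1 ≤ k
  1≤k = n≢0⇒n>0 λ k≡0 → <-irrefl refl (≤-trans 2≤a₀ (subst (λ m → entry a m ≤ 1) k≡0 entry-k≤1))

  k′ : ℕ
  k′ = pred k

  1+k′≡k : suc k′ ≡ k
  1+k′≡k = suc-pred k {{>-nonZero 1≤k}}

  k′<k : k′ < k
  k′<k = pred[m]<m 1≤k

  y : ℕ
  y = entry a k′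

  2≤y : 2 ≤ y
  2≤y = 2≤before-k k′ k′<k

  -- Otherwise a drop of two inside the first k parts and the drop from y to 0 at t
  -- give two disjoint cover moves.
  a₀≤1+y : entry a 0 ≤ suc y
  a₀≤1+y with entry a 0 ≤? suc y
  ... | yes a₀≤1+y = a₀≤1+y
  ... | no a₀≰1+y
    with coverMove-within-drop a dec k′ refl (<-trans k′<k (≤-<-trans k≤t t<n)) (≰⇒> a₀≰1+y)
       | coverMove-within-drop a dec (t ∸ k′) (m+[n∸m]≡n (<⇒≤ (<-≤-trans k′<k k≤t))) t<n
           (subst (λ e → suc (suc e) ≤ y) (sym entry-t) 2≤y)
  ... | _ , _ , _ , q₁≤k′ , move₁ | _ , _ , k′≤p₂ , _ , move₂ = ⊥-elim
    (twoCoverMoves⇒¬joinIrreducible a pa move₁ move₂ (≤-trans (≤-trans q₁≤k′ k′≤p₂) (n≤1+n _))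
      (λ q₁≡1+p₂ → ⊥-elim (<-irrefl q₁≡1+p₂ (s≤s (≤-trans q₁≤k′ k′≤p₂)))) ji)

  private opaque
    first-≤y : Σ ℕ λ r → r ≤ k′ × entry a r ≤ y × (∀ i → i < r → ¬ entry a i ≤ y)
    first-≤y = leastUpTo (λ m → entry a m ≤? y) ≤-refl

  r : ℕ
  r = proj₁ first-≤y

  entry-r≤y : entry a r ≤ y
  entry-r≤y = proj₁ (proj₂ (proj₂ first-≤y))

  y<before-r : ∀ i → i < r → y < entry a i
  y<before-r i i<r = ≰⇒> (proj₂ (proj₂ (proj₂ first-≤y)) i i<r)

  r<k : r < k
  r<k = ≤-<-trans (proj₁ (proj₂ first-≤y)) k′<k

  private
    module B = Block n r k t y r<k k≤t (<⇒≤ t<n) 2≤y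

  a≡block : a ≡ block n r k t y
  a≡block = entry-ext a B.a entries
    where
    entries : ∀ i → i < n → entry a i ≡ entry B.a i
    entries i _ with i <? r | i <? k | i <? t
    ... | yes i<r | _       | _       = trans (≤-antisym (≤-trans (antitone z≤n) a₀≤1+y) (y<before-r i i<r))
                                              (sym (B.entry-head i i<r))
    ... | no i≮r  | yes i<k | _       = trans (≤-antisym (≤-trans (antitone (≮⇒≥ i≮r)) entry-r≤y)
                                                         (antitone (≤-pred (subst (i <_) (sym 1+k′≡k) i<k))))
                                              (sym (B.entry-body i (≮⇒≥ i≮r) i<k))
    ... | no _    | no i≮k  | yes i<t = trans (≤-antisym (≤-trans (antitone (≮⇒≥ i≮k)) entry-k≤1) (positive-before-t i i<t))
                                              (sym (B.entry-ones i (≮⇒≥ i≮k) i<t))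
    ... | no _    | no _    | no i≮t  = trans (n≤0⇒n≡0 (≤-trans (antitone (≮⇒≥ i≮t)) (≤-reflexive entry-t)))
                                              (sym (B.entry-tail i (≮⇒≥ i≮t)))

  s : ℕ
  s = r + y * suc k′

  n≡s+[t∸k] : n ≡ s + (t ∸ k)
  n≡s+[t∸k] = begin
    n                               ≡⟨ sym (proj₂ pa) ⟩
    psum a n                        ≡⟨ cong (λ v → psum v n) a≡block ⟩
    psum B.a n                      ≡⟨ B.psum-total ⟩
    r + pred y * k + t              ≡⟨ cong (r + pred y * k +_) (sym (m+[n∸m]≡n k≤t)) ⟩
    r + pred y * k + (k + (t ∸ k))  ≡⟨ sym (+-assoc (r + pred y * k) k (t ∸ k)) ⟩
    r + pred y * k + k + (t ∸ k)    ≡⟨ cong (_+ (t ∸ k)) (r+pred[y]*k+k≡r+y*k r k (≤-trans (s≤s z≤n) 2≤y)) ⟩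
    r + y * k + (t ∸ k)             ≡⟨ cong (λ m → r + y * m + (t ∸ k)) (sym 1+k′≡k) ⟩
    s + (t ∸ k)                     ∎
    where open ≡-Reasoning

  realise≡block : realise n k′ s ≡ block n r k t y
  realise≡block = block-cong
    (trans ([m+kn]%n≡m%n r y (suc k′)) (m<n⇒m%n≡m r<1+k′)) 1+k′≡k
    (begin
      suc k′ + (n ∸ s)  ≡⟨ cong₂ _+_ 1+k′≡k (trans (cong (_∸ s) n≡s+[t∸k]) (m+n∸m≡n s (t ∸ k))) ⟩
      k + (t ∸ k)       ≡⟨ m+[n∸m]≡n k≤t ⟩
      t                 ∎)
    ([r+y*k]/k≡y y r<1+k′)
    where
    open ≡-Reasoning
    r<1+k′ = subst (r <_) (sym 1+k′≡k) r<k
    block-cong : ∀ {r₁ r₂ k₁ k₂ t₁ t₂ y₁ y₂} → r₁ ≡ r₂ → k₁ ≡ k₂ → t₁ ≡ t₂ → y₁ ≡ y₂ →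
                 block n r₁ k₁ t₁ y₁ ≡ block n r₂ k₂ t₂ y₂
    block-cong refl refl refl refl = refl

  admissible : Admissible n k′ s
  admissible = ≤-trans (*-monoˡ-≤ (suc k′) 2≤y) (m≤n+m (y * suc k′) r) , s≤n , shape
    where
    s≤n = subst (s ≤_) (sym n≡s+[t∸k]) (m≤m+n s (t ∸ k))
    y≡2 : ¬ (3 ≤ y) → y ≡ 2
    y≡2 3≰y = ≤-antisym (≤-pred (≰⇒> 3≰y)) 2≤y
    shape : s ≡ n ⊎ 3 * suc k′ ≤ s ⊎ s ≡ 2 * suc k′
    shape with t ≟ k | 3 ≤? y | r ≟ 0
    ... | yes t≡k | _       | _      = inj₁ (sym (trans n≡s+[t∸k] (trans (cong (λ m → s + (m ∸ k)) t≡k)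
                                                                       (trans (cong (s +_) (n∸n≡0 k)) (+-identityʳ s)))))
    ... | no _    | yes 3≤y | _      = inj₂ (inj₁ (≤-trans (*-monoˡ-≤ (suc k′) 3≤y) (m≤n+m (y * suc k′) r)))
    ... | no _    | no 3≰y  | yes r≡0 = inj₂ (inj₂ (cong₂ (λ u v → u + v * suc k′) r≡0 (y≡2 3≰y)))
    ... | no t≢k  | no 3≰y  | no r≢0 = ⊥-elim
      (block-¬joinIrreducible r<k k≤t (<⇒≤ t<n) 2≤y (n≢0⇒n>0 r≢0) (≤∧≢⇒< k≤t (≢-sym t≢k)) t<n (y≡2 3≰y)
        (subst (IsPartition′ n) a≡block pa) (subst (JoinIrreducible n) a≡block ji))

  joinIrreducible⇒realised : Σ ℕ λ k′ → Σ ℕ λ s → Admissible n k′ s × a ≡ realise n k′ s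
  joinIrreducible⇒realised = k′ , s , admissible , trans a≡block (sym realise≡block)

map⁺-on : ∀ {A B : Set} {f : A → B} {xs : List A} → (∀ {x y} → x ∈ xs → y ∈ xs → f x ≡ f y → x ≡ y) →
          Unique xs → Unique (map f xs)
map⁺-on injective [] = []
map⁺-on injective (x∉xs ∷ unique) =
  All.map⁺ (All.tabulate λ y∈ fx≡fy → All.lookup x∉xs y∈ (injective (here refl) (there y∈) fx≡fy))
  ∷ map⁺-on (λ x∈ y∈ → injective (there x∈) (there y∈)) unique

-- Counting

AdmissiblePair : ℕ → ℕ × ℕ → Set
AdmissiblePair n p = Admissible n (proj₁ p) (proj₂ p)

-- Passing from n to n + 1 turns the pairs with s = n into the pairs with s = n + 1.
liftPair : ℕ → ℕ × ℕ → ℕ × ℕ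
liftPair n (k′ , s) with s ≟ n
... | yes _ = k′ , suc s
... | no _  = k′ , s

liftPair-full : ∀ n k′ → liftPair n (k′ , n) ≡ (k′ , suc n)
liftPair-full n k′ with n ≟ n
... | yes _  = refl
... | no n≢n = ⊥-elim (n≢n refl)

liftPair-partial : ∀ {n s} k′ → s ≢ n → liftPair n (k′ , s) ≡ (k′ , s)
liftPair-partial {n} {s} k′ s≢n with s ≟ n
... | yes s≡n = ⊥-elim (s≢n s≡n)
... | no _    = refl

liftPair-admissible : ∀ {n} p → AdmissiblePair n p → AdmissiblePair (suc n) (liftPair n p)
liftPair-admissible {n} (k′ , s) (2k≤s , s≤n , shape) with s ≟ n
... | yes refl = ≤-trans 2k≤s (n≤1+n s) , ≤-refl , inj₁ refl
... | no s≢n   = 2k≤s , m≤n⇒m≤1+n s≤n , inj₂ (case shape of λ where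
                   (inj₁ s≡n)   → ⊥-elim (s≢n s≡n)
                   (inj₂ other) → other)

liftPair-injective : ∀ {n} p p′ → AdmissiblePair n p → AdmissiblePair n p′ → liftPair n p ≡ liftPair n p′ → p ≡ p′
liftPair-injective {n} (k₁ , s₁) (k₂ , s₂) adm₁ adm₂ same with s₁ ≟ n | s₂ ≟ n
... | yes refl | yes refl = cong (_, s₁) (,-injectiveˡ same)
... | yes refl | no _     = ⊥-elim (<-irrefl (sym (,-injectiveʳ same)) (s≤s (proj₁ (proj₂ adm₂))))
... | no _     | yes refl = ⊥-elim (<-irrefl (,-injectiveʳ same) (s≤s (proj₁ (proj₂ adm₁))))
... | no _     | no _     = same

halfPred : ℕ → ℕ
halfPred n = (n ∸ 1) / 2

evenPair : ℕ → ℕ × ℕ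
evenPair n = halfPred n , 2 * suc (halfPred n)

evenPair-sum-≤ : ∀ n → 1 ≤ n → 2 * suc (halfPred n) ≤ suc n
evenPair-sum-≤ (suc m) _ = subst (_≤ suc (suc m)) (*-comm (suc (m / 2)) 2) (s≤s (s≤s (m/n*n≤m m 2)))

evenPair-sum-≥ : ∀ n → n ≤ 2 * suc (halfPred n)
evenPair-sum-≥ zero    = z≤n
evenPair-sum-≥ (suc m) = subst (suc m ≤_) (*-comm (suc (m / 2)) 2) (s≤s (begin
  m                    ≡⟨ m≡m%n+[m/n]*n m 2 ⟩
  m % 2 + m / 2 * 2    ≤⟨ +-monoˡ-≤ (m / 2 * 2) (≤-pred (m%n<n m 2)) ⟩
  suc (m / 2 * 2)      ∎))
  where open ≤-Reasoning

halfPred-even : ∀ k′ → halfPred (2 * suc k′) ≡ k′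
halfPred-even k′ = trans (cong (λ m → (m ∸ 1) / 2) (*-comm 2 (suc k′))) ([r+y*k]/k≡y {1} k′ ≤-refl)

halfPred-odd : ∀ k′ → halfPred (suc (2 * k′)) ≡ k′
halfPred-odd k′ = trans (cong (_/ 2) (*-comm 2 k′)) ([r+y*k]/k≡y {0} k′ (s≤s z≤n))

evenPair≡ : ∀ {n k′} → halfPred n ≡ k′ → (k′ , 2 * suc k′) ≡ evenPair n
evenPair≡ refl = refl

-- Besides the lifted pairs, n + 1 has the pairs (k′ , n) with 3(k′ + 1) ≤ n, and the
-- single pair with s = 2(k′ + 1) ∈ {n , n + 1}.
newPairs : ℕ → List (ℕ × ℕ)
newPairs n = map (_, n) (upTo (n / 3)) ++ evenPair n ∷ []

<n/3⇒3*[1+k′]≤n : ∀ {n k′} → k′ < n / 3 → 3 * suc k′ ≤ n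
<n/3⇒3*[1+k′]≤n {n} {k′} k′<n/3 = subst (_≤ n) (*-comm (suc k′) 3) (≤-trans (*-monoˡ-≤ 3 k′<n/3) (m/n*n≤m n 3))

newPair-admissible : ∀ {n} → 1 ≤ n → ∀ p → p ∈ newPairs n → AdmissiblePair (suc n) p
newPair-admissible {n} 1≤n p p∈ with ∈-++⁻ (map (_, n) (upTo (n / 3))) p∈
... | inj₂ (here refl) = ≤-refl , evenPair-sum-≤ n 1≤n , inj₂ (inj₂ refl)
... | inj₁ p∈map with ∈-map⁻ (_, n) p∈map
...   | k′ , k′∈ , refl = ≤-trans (*-monoˡ-≤ (suc k′) (n≤1+n 2)) 3k≤n , n≤1+n n , inj₂ (inj₁ 3k≤n)
  where 3k≤n = <n/3⇒3*[1+k′]≤n (∈-upTo⁻ k′∈)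

newPairs-unique : ∀ n → Unique (newPairs n)
newPairs-unique n = Unique.++⁺ (Unique.map⁺ ,-injectiveˡ (Unique.upTo⁺ (n / 3))) (All.[] ∷ []) disjoint
  where
  disjoint : Disjoint (map (_, n) (upTo (n / 3))) (evenPair n ∷ [])
  disjoint (p∈map , here refl) with ∈-map⁻ (_, n) p∈map
  ... | k′ , k′∈ , same = <-irrefl refl (<-≤-trans n<3k (<n/3⇒3*[1+k′]≤n (∈-upTo⁻ k′∈)))
    where
    n<3k : n < 3 * suc k′
    n<3k rewrite sym (,-injectiveʳ same) | ,-injectiveˡ same = *-monoˡ-< (suc k′) (≤-refl {3})

admissiblePairs : ℕ → List (ℕ × ℕ)
admissiblePairs zero          = []
admissiblePairs (suc zero)    = []
admissiblePairs (suc (suc m)) = map (liftPair (suc m)) (admissiblePairs (suc m)) ++ newPairs (suc m)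

admissiblePairs-sound : ∀ {m} p → p ∈ admissiblePairs (suc m) → AdmissiblePair (suc m) p
admissiblePairs-sound {suc m} p p∈ with ∈-++⁻ (map (liftPair (suc m)) (admissiblePairs (suc m))) p∈
... | inj₂ p∈new = newPair-admissible (s≤s z≤n) p p∈new
... | inj₁ p∈lifted with ∈-map⁻ (liftPair (suc m)) p∈lifted
...   | q , q∈ , refl = liftPair-admissible q (admissiblePairs-sound {m} q q∈)

lifted-disjoint-new : ∀ {n} (ps : List (ℕ × ℕ)) → (∀ p → p ∈ ps → AdmissiblePair n p) →
                      Disjoint (map (liftPair n) ps) (newPairs n)
lifted-disjoint-new {n} ps admissible (p∈lifted , p∈new) with ∈-map⁻ (liftPair n) p∈lifted
... | (k′ , s) , q∈ , refl with admissible (k′ , s) q∈ | s ≟ n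
...   | 2k≤s , s≤n , _ | yes refl = case ∈-++⁻ (map (_, s) (upTo (s / 3))) p∈new of λ where
  (inj₁ p∈map) → let _ , _ , same = ∈-map⁻ (_, s) p∈map in <-irrefl (sym (,-injectiveʳ same)) (n<1+n s)
  (inj₂ (here same)) → <-irrefl refl (≤-trans (≤-reflexive (trans (,-injectiveʳ same)
                          (cong (λ h → 2 * suc h) (sym (,-injectiveˡ same))))) 2k≤s)
...   | _ , s≤n , _ | no s≢n = case ∈-++⁻ (map (_, n) (upTo (n / 3))) p∈new of λ where
  (inj₁ p∈map) → let _ , _ , same = ∈-map⁻ (_, n) p∈map in s≢n (,-injectiveʳ same)
  (inj₂ (here same)) → <-irrefl refl (<-≤-trans (≤∧≢⇒< s≤n s≢n)
                          (≤-trans (evenPair-sum-≥ n) (≤-reflexive (sym (,-injectiveʳ same)))))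

admissiblePairs-unique : ∀ n → Unique (admissiblePairs n)
admissiblePairs-unique zero          = []
admissiblePairs-unique (suc zero)    = []
admissiblePairs-unique (suc (suc m)) =
  Unique.++⁺ (map⁺-on (λ {p} {p′} p∈ p′∈ → liftPair-injective p p′ (admissiblePairs-sound {m} p p∈) (admissiblePairs-sound {m} p′ p′∈))
                      (admissiblePairs-unique (suc m)))
             (newPairs-unique (suc m))
             (lifted-disjoint-new (admissiblePairs (suc m)) (admissiblePairs-sound {m}))

admissiblePairs-complete : ∀ {m k′ s} → Admissible (suc m) k′ s → (k′ , s) ∈ admissiblePairs (suc m)
admissiblePairs-complete {zero} {k′} (2k≤s , s≤1 , _) =
  ⊥-elim (<-irrefl refl (≤-trans (*-monoʳ-≤ 2 (s≤s (z≤n {k′}))) (≤-trans 2k≤s s≤1)))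
admissiblePairs-complete {suc m} {k′} {s} (2k≤s , s≤2+m , shape) with s ≟ suc (suc m) | s ≟ suc m
... | yes refl | _ = full (2 * suc k′ ≤? suc m)
  where
  full : Dec (2 * suc k′ ≤ suc m) → (k′ , suc (suc m)) ∈ admissiblePairs (suc (suc m))
  full (yes 2k≤1+m) = ∈-++⁺ˡ (subst (_∈ map (liftPair (suc m)) (admissiblePairs (suc m))) (liftPair-full (suc m) k′)
                        (∈-map⁺ (liftPair (suc m)) (admissiblePairs-complete {m} (2k≤1+m , ≤-refl , inj₁ refl))))
  full (no 2k≰1+m) = ∈-++⁺ʳ (map (liftPair (suc m)) (admissiblePairs (suc m))) (∈-++⁺ʳ (map (_, suc m) (upTo (suc m / 3)))
                       (here (trans (cong (k′ ,_) (sym 2k≡2+m)) (evenPair≡ {suc m} (trans (cong halfPred 1+m≡1+2k′) (halfPred-odd k′))))))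
    where
    2k≡2+m : 2 * suc k′ ≡ suc (suc m)
    2k≡2+m = ≤-antisym 2k≤s (≰⇒> 2k≰1+m)
    1+m≡1+2k′ : suc m ≡ suc (2 * k′)
    1+m≡1+2k′ = suc-injective (trans (sym 2k≡2+m) (cong suc (+-suc k′ (k′ + 0))))
... | no s≢2+m | yes refl = case shape of λ where
  (inj₁ 1+m≡2+m) → ⊥-elim (<-irrefl 1+m≡2+m (n<1+n (suc m)))
  (inj₂ (inj₁ 3k≤1+m)) → ∈-++⁺ʳ (map (liftPair (suc m)) (admissiblePairs (suc m))) (∈-++⁺ˡ (∈-map⁺ (_, suc m)
                             (∈-upTo⁺ (*≤⇒≤/ (suc k′) (subst (_≤ suc m) (*-comm 3 (suc k′)) 3k≤1+m)))))
  (inj₂ (inj₂ 1+m≡2k)) → ∈-++⁺ʳ (map (liftPair (suc m)) (admissiblePairs (suc m))) (∈-++⁺ʳ (map (_, suc m) (upTo (suc m / 3)))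
                             (here (trans (cong (k′ ,_) 1+m≡2k) (evenPair≡ {suc m} (trans (cong halfPred 1+m≡2k) (halfPred-even k′))))))
... | no s≢2+m | no s≢1+m = ∈-++⁺ˡ (subst (_∈ map (liftPair (suc m)) (admissiblePairs (suc m))) (liftPair-partial k′ s≢1+m)
                              (∈-map⁺ (liftPair (suc m)) (admissiblePairs-complete {m} (2k≤s , ≤-pred (≤∧≢⇒< s≤2+m s≢2+m) , shape′))))
  where
  shape′ : s ≡ suc m ⊎ 3 * suc k′ ≤ s ⊎ s ≡ 2 * suc k′
  shape′ = case shape of λ where
    (inj₁ s≡2+m) → ⊥-elim (s≢2+m s≡2+m)
    (inj₂ other) → inj₂ other

length-admissiblePairs : ∀ m → length (admissiblePairs (suc (suc m))) ≡ length (admissiblePairs (suc m)) + suc m / 3 + 1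
length-admissiblePairs m = begin
  length (map (liftPair (suc m)) ps ++ newPairs (suc m))        ≡⟨ length-++ (map (liftPair (suc m)) ps) ⟩
  length (map (liftPair (suc m)) ps) + length (newPairs (suc m)) ≡⟨ cong₂ _+_ (length-map (liftPair (suc m)) ps) new ⟩
  length ps + (suc m / 3 + 1)                                   ≡⟨ sym (+-assoc (length ps) (suc m / 3) 1) ⟩
  length ps + suc m / 3 + 1                                     ∎
  where
  open ≡-Reasoning
  ps = admissiblePairs (suc m)
  new : length (newPairs (suc m)) ≡ suc m / 3 + 1
  new = trans (length-++ (map (_, suc m) (upTo (suc m / 3))))
              (cong (_+ 1) (trans (length-map (_, suc m) (upTo (suc m / 3))) (length-upTo (suc m / 3))))

joinIrreducibles : (n : ℕ) → List (Vec ℕ n)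
joinIrreducibles n = map (uncurry (realise n)) (admissiblePairs n)

joinIrreducibles-unique : ∀ m → Unique (joinIrreducibles (suc m))
joinIrreducibles-unique m =
  map⁺-on (λ {p} {p′} p∈ p′∈ → realise-injective {suc m} {proj₁ p} {proj₂ p} {proj₁ p′} {proj₂ p′}
                                  (admissiblePairs-sound {m} p p∈) (admissiblePairs-sound {m} p′ p′∈))
          (admissiblePairs-unique (suc m))

∈-joinIrreducibles⇒joinIrreducible : ∀ m a → a ∈ joinIrreducibles (suc m) → IsPartition (suc m) a × JoinIrreducible (suc m) a
∈-joinIrreducibles⇒joinIrreducible m a a∈ with ∈-map⁻ (uncurry (realise (suc m))) a∈
... | p , p∈ , refl = IsPartition′⇒IsPartition a (Realise.realise-isPartition′ adm) , Realise.joinIrreducible adm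
  where adm = admissiblePairs-sound {m} p p∈

realised⇒∈-joinIrreducibles : ∀ m a → (Σ ℕ λ k′ → Σ ℕ λ s → Admissible (suc m) k′ s × a ≡ realise (suc m) k′ s) →
                              a ∈ joinIrreducibles (suc m)
realised⇒∈-joinIrreducibles m a (k′ , s , adm , a≡realise) = subst (_∈ joinIrreducibles (suc m)) (sym a≡realise)
  (∈-map⁺ (uncurry (realise (suc m))) {x = k′ , s} (admissiblePairs-complete adm))

joinIrreducible⇒∈-joinIrreducibles : ∀ m a → IsPartition (suc m) a → JoinIrreducible (suc m) a → a ∈ joinIrreducibles (suc m)
joinIrreducible⇒∈-joinIrreducibles m a pa ji =
  realised⇒∈-joinIrreducibles m a (Reconstruct.joinIrreducible⇒realised a (IsPartition⇒IsPartition′ a pa) ji)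

numJoinIrreducibles : ∀ m → NumJoinIrreducibles (suc m) (length (admissiblePairs (suc m)))
numJoinIrreducibles m = joinIrreducibles (suc m) , joinIrreducibles-unique m ,
  ∈-joinIrreducibles⇒joinIrreducible m , joinIrreducible⇒∈-joinIrreducibles m ,
  length-map (uncurry (realise (suc m))) (admissiblePairs (suc m))

NumJoinIrreducibles-functional : ∀ {n k k′} → NumJoinIrreducibles n k → NumJoinIrreducibles n k′ → k ≡ k′
NumJoinIrreducibles-functional {n} (L , unique , sound , complete , refl) (L′ , unique′ , sound′ , complete′ , refl) =
  ↭-length (∼bag⇒↭ (unique∧set⇒bag unique unique′ (mk⇔ (⊆ sound complete′) (⊆ sound′ complete))))
  where
  ⊆ : ∀ {L L′ : List (Vec ℕ n)} → (∀ a → a ∈ L → IsPartition n a × JoinIrreducible n a) →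
      (∀ a → IsPartition n a → JoinIrreducible n a → a ∈ L′) → ∀ {a} → a ∈ L → a ∈ L′
  ⊆ sound complete {a} a∈ = complete a (proj₁ (sound a a∈)) (proj₂ (sound a a∈))

theorem4 : NumJoinIrreducibles 1 0 ×
    (∀ (n k : ℕ) → 1 ≤ n → NumJoinIrreducibles n k →
      NumJoinIrreducibles (suc n) (k + n / 3 + 1))
theorem4 = numJoinIrreducibles 0 , step
  where
  step : ∀ (n k : ℕ) → 1 ≤ n → NumJoinIrreducibles n k → NumJoinIrreducibles (suc n) (k + n / 3 + 1)
  step (suc m) k _ count = subst (NumJoinIrreducibles (suc (suc m)))
    (begin
      length (admissiblePairs (suc (suc m)))          ≡⟨ length-admissiblePairs m ⟩
      length (admissiblePairs (suc m)) + suc m / 3 + 1 ≡⟨ cong (λ c → c + suc m / 3 + 1) (NumJoinIrreducibles-functional (numJoinIrreducibles m) count) ⟩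
      k + suc m / 3 + 1                               ∎)
    (numJoinIrreducibles (suc m))
    where open ≡-Reasoning
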